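{- If a signed graph $(G,\sigma)$ has a $(k,d)$-coloring, and $k'$ and $d'$ are positive integers such that $\frac{k}{d}<\frac{k'}{d'}$, then $(G,\sigma)$ has a $(k',d')$-coloring.
   Context: Graphs are simple and finite. A signed graph $(G,\sigma)$ is a graph $G$ with a map $\sigma:E(G)\to\{\pm1\}$. For $x\in\mathbb{R}$ and $r>0$, $[x]_r\in[0,r)$ is the remainder of $x$ modulo $r$ and $|x|_r=\min\{[x]_r,[-x]_r\}$. For positive integers $k\ge 2d$, a $(k,d)$-coloring of $(G,\sigma)$ is a map $c:V(G)\to\mathbb{Z}_k$ such that $|c(v)-\sigma(e)c(w)|_k\ge d$ for every edge $e=vw$. -}

module Defs where

open import Data.Nat using (ℕ; suc; _≤_; _*_; _<_; NonZero)
open import Data.Nat.Base using (_⊓_; _∸_)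
open import Data.Integer as ℤ using (ℤ; +_)
open import Data.Integer.DivMod using (_%ℕ_)
open import Data.Fin using (Fin; toℕ)
open import Data.Product using (Σ)
open import Relation.Nullary using (¬_)
open import Relation.Binary.PropositionalEquality using (_≡_)

data Sign : Set where
  plus minus : Sign

⟦_⟧ : Sign → ℤ
⟦ plus ⟧ = + 1
⟦ minus ⟧ = ℤ.- (+ 1)

record Graph : Set₁ where
  field
    n     : ℕ
    Adj   : Fin n → Fin n → Set
    sym   : ∀ {v w} → Adj v w → Adj w v
    irrefl : ∀ {v} → ¬ Adj v v
open Graph public

record SignedGraph : Set₁ where
  field
    graph : Graph
    σ     : (v w : Fin (n graph)) → Adj graph v w → Sign
    σ-sym : ∀ {v w} (e : Adj graph v w) → σ v w e ≡ σ w v (sym graph e)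
open SignedGraph public

[_]_ : ℤ → (k : ℕ) → .{{NonZero k}} → ℕ
[ x ] k = x %ℕ k

∣_∣_ : ℤ → (k : ℕ) → .{{NonZero k}} → ℕ
∣ x ∣ k = ([ x ] k) ⊓ ([ ℤ.- x ] k)

IsKDColoring : (S : SignedGraph) (k d : ℕ) .{{_ : NonZero k}} →
               (Fin (n (graph S)) → Fin k) → Set
IsKDColoring S k d c =
  ∀ v w (e : Adj (graph S) v w) →
    d ≤ ∣ (+ toℕ (c v)) ℤ.- (⟦ σ S v w e ⟧ ℤ.* (+ toℕ (c w))) ∣ k

HasKDColoring : (S : SignedGraph) (k d : ℕ) .{{_ : NonZero k}} → Set
HasKDColoring S k d =
  Σ (Fin (n (graph S)) → Fin k) (λ c → IsKDColoring S k d c)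

-- Rescale the colours: send x ∈ ℤ_k to the integer nearest to x K / k, reduced mod K.
-- If x − ε y ≡ t (mod k) with d ≤ t ≤ k − d, the two roundings each move by at most 1/2,
-- so the images differ (mod K) by an integer v with 2k v = 2K t + E and −2k < E ≤ 2k.
-- Since K d / k > D, this confines v to the window D ≤ v ≤ K − D.

module Submission where

open import Data.Fin using (Fin; toℕ; fromℕ<)
open import Data.Fin.Properties using (toℕ-fromℕ<)
open import Data.Integer
  using (ℤ; +_; +0; -[1+_]; +[1+_]; -_; _+_; _-_; _*_; _≤_; _<_; +≤+; +<+; -<-; _/ℕ_; _%ℕ_)
open import Data.Integer.DivMod using (a≡a%ℕn+[a/ℕn]*n; n%ℕd<d)
open import Data.Integer.Properties
  using ( +-injective; pos-+; pos-*; drop‿+≤+; i-j≡0⇒i≡j; *-identityˡ; *-assoc; -1*i≡-i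
        ; neg-mono-<; +-monoʳ-<; +-monoˡ-<; +-monoʳ-≤; +-monoˡ-≤; ≤-<-trans; <-≤-trans
        ; *-cancelʳ-<-nonNeg; *-cancelˡ-<-nonNeg; *-monoˡ-≤-nonNeg; *-monoˡ-<-pos
        ; i≤j+i; i<j⇒i≤pred[j]; +-inverseˡ; +-identityʳ; +-identityˡ; +-assoc; +-mono-<; +-mono-≤; neg-mono-≤; <⇒≤; pred-suc; i≤j⇒i-k≤j; module ≤-Reasoning)
open import Data.Integer.Tactic.RingSolver using (solve-∀)
open import Data.Nat as ℕ using (ℕ; NonZero; s≤s; z≤n)
import Data.Nat.Properties as ℕₚ
open import Data.Product using (_×_; _,_; proj₁; proj₂)
open import Function using (_∘_)
open import Relation.Binary.PropositionalEquality
  using (_≡_; refl; sym; trans; cong; cong₂; subst; subst₂; module ≡-Reasoning)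

open import Defs hiding (sym)

-1<i<1⇒i≡0 : ∀ {i} → -[1+ 0 ] < i → i < + 1 → i ≡ +0
-1<i<1⇒i≡0 {+0}       _          _                = refl
-1<i<1⇒i≡0 {+[1+ _ ]} _          (+<+ (s≤s ()))
-1<i<1⇒i≡0 { -[1+ _ ]} (-<- ()) _

[t+q*n]%ℕn≡t : ∀ {n} .{{_ : NonZero n}} {t} (q : ℤ) → t ℕ.< n → (+ t + q * + n) %ℕ n ≡ t
[t+q*n]%ℕn≡t {n} {t} q t<n = sym (+-injective (i-j≡0⇒i≡j (+ t) (+ r) t-r≡0))
  where
  z = + t + q * + n
  r = z %ℕ n
  p = z /ℕ n

  multiple : (p - q) * + n ≡ + t - + r
  multiple = begin
    (p - q) * + n                          ≡⟨ regroup (+ t) (+ r) p q (+ n) ⟩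
    ((+ r + p * + n) - z) + (+ t - + r)    ≡⟨ cong (λ w → (w - z) + (+ t - + r)) (sym (a≡a%ℕn+[a/ℕn]*n z n)) ⟩
    (z - z) + (+ t - + r)                  ≡⟨ cancel z (+ t - + r) ⟩
    + t - + r                              ∎
    where
    open ≡-Reasoning
    regroup : ∀ t r p q n → (p - q) * n ≡ ((r + p * n) - (t + q * n)) + (t - r)
    regroup = solve-∀
    cancel : ∀ z w → (z - z) + w ≡ w
    cancel = solve-∀

  -n<t-r : - + n < + t - + r
  -n<t-r = <-≤-trans (neg-mono-< (+<+ (n%ℕd<d z n))) (i≤j+i (- + r) (+ t))

  t-r<n : + t - + r < + n
  t-r<n = ≤-<-trans (i≤j⇒i-k≤j (+ r) (+≤+ ℕₚ.≤-refl)) (+<+ t<n)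

  t-r≡0 : + t - + r ≡ +0
  t-r≡0 = begin
    + t - + r      ≡⟨ sym multiple ⟩
    (p - q) * + n  ≡⟨ cong (_* + n) (-1<i<1⇒i≡0 -1<p-q p-q<1) ⟩
    +0             ∎
    where
    open ≡-Reasoning
    -1<p-q : -[1+ 0 ] < p - q
    -1<p-q = *-cancelʳ-<-nonNeg (+ n) (subst₂ _<_ (sym (-1*i≡-i (+ n))) (sym multiple) -n<t-r)
    p-q<1 : p - q < + 1
    p-q<1 = *-cancelʳ-<-nonNeg (+ n) (subst₂ _<_ (sym multiple) (sym (*-identityˡ (+ n))) t-r<n)

[-[t+q*n]]%ℕn≡n∸t : ∀ {n} .{{_ : NonZero n}} {t} (q : ℤ) → 0 ℕ.< t → t ℕ.< n →
                    (- (+ t + q * + n)) %ℕ n ≡ n ℕ.∸ t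
[-[t+q*n]]%ℕn≡n∸t {n} {t} q 0<t t<n = begin
  (- (+ t + q * + n)) %ℕ n                ≡⟨ cong (_%ℕ n) negated ⟩
  (+ (n ℕ.∸ t) + (- q - + 1) * + n) %ℕ n  ≡⟨ [t+q*n]%ℕn≡t (- q - + 1) (ℕₚ.∸-monoʳ-< 0<t (ℕₚ.<⇒≤ t<n)) ⟩
  n ℕ.∸ t                                 ∎
  where
  open ≡-Reasoning
  n≡t+[n∸t] : + n ≡ + t + + (n ℕ.∸ t)
  n≡t+[n∸t] = trans (cong +_ (sym (ℕₚ.m+[n∸m]≡n (ℕₚ.<⇒≤ t<n)))) (pos-+ t (n ℕ.∸ t))
  negated : - (+ t + q * + n) ≡ + (n ℕ.∸ t) + (- q - + 1) * + n
  negated = subst (λ m → - (+ t + q * m) ≡ + (n ℕ.∸ t) + (- q - + 1) * m) (sym n≡t+[n∸t])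
                  (identity (+ t) (+ (n ℕ.∸ t)) q)
    where
    identity : ∀ t u q → - (t + q * (t + u)) ≡ u + (- q - + 1) * (t + u)
    identity = solve-∀

record FarResidue (k d : ℕ) (z : ℤ) : Set where
  constructor farResidue
  field
    rep          : ℕ
    quot         : ℤ
    z≡rep+quot*k : z ≡ + rep + quot * + k
    d≤rep        : d ℕ.≤ rep
    rep+d≤k      : rep ℕ.+ d ℕ.≤ k

≤∣∣⇒FarResidue : ∀ {k} .{{_ : NonZero k}} {d z} → 0 ℕ.< d → d ℕ.≤ ∣ z ∣ k → FarResidue k d z
≤∣∣⇒FarResidue {k} {d} {z} 0<d d≤∣z∣ = farResidue t q z≡t+qk d≤t t+d≤k
  where
  t = z %ℕ k
  q = z /ℕ k
  z≡t+qk : z ≡ + t + q * + k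
  z≡t+qk = a≡a%ℕn+[a/ℕn]*n z k
  d≤t : d ℕ.≤ t
  d≤t = ℕₚ.≤-trans d≤∣z∣ (ℕₚ.m⊓n≤m _ _)
  [-z]%ℕk≡k∸t : (- z) %ℕ k ≡ k ℕ.∸ t
  [-z]%ℕk≡k∸t = trans (cong (λ w → (- w) %ℕ k) z≡t+qk)
                      ([-[t+q*n]]%ℕn≡n∸t q (ℕₚ.<-≤-trans 0<d d≤t) (n%ℕd<d z k))
  t+d≤k : t ℕ.+ d ℕ.≤ k
  t+d≤k = subst (ℕ._≤ k) (ℕₚ.+-comm d t)
            (ℕₚ.m≤o∸n⇒m+n≤o d (ℕₚ.<⇒≤ (n%ℕd<d z k))
              (subst (d ℕ.≤_) [-z]%ℕk≡k∸t (ℕₚ.≤-trans d≤∣z∣ (ℕₚ.m⊓n≤n _ _))))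

FarResidue⇒≤∣∣ : ∀ {k} .{{_ : NonZero k}} {d z} → 0 ℕ.< d → FarResidue k d z → d ℕ.≤ ∣ z ∣ k
FarResidue⇒≤∣∣ {k} {d} 0<d (farResidue t q refl d≤t t+d≤k) =
  ℕₚ.⊓-glb (subst (d ℕ.≤_) (sym ([t+q*n]%ℕn≡t q t<k)) d≤t)
           (subst (d ℕ.≤_) (sym ([-[t+q*n]]%ℕn≡n∸t q (ℕₚ.<-≤-trans 0<d d≤t) t<k))
                  (ℕₚ.m+n≤o⇒m≤o∸n d (subst (ℕ._≤ k) (ℕₚ.+-comm t d) t+d≤k)))
  where
  t<k : t ℕ.< k
  t<k = ℕₚ.<-≤-trans (ℕₚ.m<m+n t 0<d) t+d≤k

FarResidue-+* : ∀ {k d z} p → FarResidue k d (z + p * + k) → FarResidue k d z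
FarResidue-+* {k} {z = z} p (farResidue t q eq d≤t t+d≤k) = farResidue t (q - p) z≡t+[q-p]k d≤t t+d≤k
  where
  open ≡-Reasoning
  z≡t+[q-p]k : z ≡ + t + (q - p) * + k
  z≡t+[q-p]k = begin
    z                               ≡⟨ unshift z p (+ k) ⟩
    (z + p * + k) - p * + k         ≡⟨ cong (_- p * + k) eq ⟩
    (+ t + q * + k) - p * + k       ≡⟨ regroup (+ t) q p (+ k) ⟩
    + t + (q - p) * + k             ∎
    where
    unshift : ∀ z p k → z ≡ (z + p * k) - p * k
    unshift = solve-∀
    regroup : ∀ t q p k → (t + q * k) - p * k ≡ t + (q - p) * k
    regroup = solve-∀

FarResidue-%ℕ : ∀ {K} .{{_ : NonZero K}} {D} ε x y →
                FarResidue K D (x - ε * y) → FarResidue K D (+ (x %ℕ K) - ε * + (y %ℕ K))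
FarResidue-%ℕ {K} {D} ε x y far = FarResidue-+* (x /ℕ K - ε * (y /ℕ K)) (subst (FarResidue K D) split far)
  where
  open ≡-Reasoning
  split : x - ε * y ≡ (+ (x %ℕ K) - ε * + (y %ℕ K)) + (x /ℕ K - ε * (y /ℕ K)) * + K
  split = begin
    x - ε * y
      ≡⟨ cong₂ (λ a b → a - ε * b) (a≡a%ℕn+[a/ℕn]*n x K) (a≡a%ℕn+[a/ℕn]*n y K) ⟩
    (+ (x %ℕ K) + x /ℕ K * + K) - ε * (+ (y %ℕ K) + y /ℕ K * + K)
      ≡⟨ regroup (+ (x %ℕ K)) (+ (y %ℕ K)) (x /ℕ K) (y /ℕ K) ε (+ K) ⟩
    (+ (x %ℕ K) - ε * + (y %ℕ K)) + (x /ℕ K - ε * (y /ℕ K)) * + K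
      ∎
    where
    regroup : ∀ a b p q ε K → (a + p * K) - ε * (b + q * K) ≡ (a - ε * b) + (p - ε * q) * K
    regroup = solve-∀

FarResidue-intro : ∀ {K D} {w} (q v : ℤ) → w ≡ v + q * + K → + D ≤ v → v + + D ≤ + K → FarResidue K D w
FarResidue-intro {K} {D} q (+ u) w≡u+qK (+≤+ D≤u) u+D≤K =
  farResidue u q w≡u+qK D≤u (drop‿+≤+ (subst (_≤ + K) (sym (pos-+ u D)) u+D≤K))

<1+⇒≤ : ∀ {i j} → i < + 1 + j → i ≤ j
<1+⇒≤ {j = j} i<1+j = subst (_ ≤_) (pred-suc j) (i<j⇒i≤pred[j] i<1+j)

rescale-window : ∀ {k K d D t} {v E : ℤ} → k ℕ.* D ℕ.< K ℕ.* d → d ℕ.≤ t → t ℕ.+ d ℕ.≤ k →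
                 - (+ 2 * + k) < E × E ≤ + 2 * + k → + 2 * (+ k * v) ≡ + 2 * (+ K * + t) + E →
                 + D ≤ v × v + + D ≤ + K
rescale-window {k} {K} {d} {D} {t} {v} {E} kD<Kd d≤t t+d≤k (-2k<E , E≤2k) 2kv≡2Kt+E =
  <1+⇒≤ (cancel-2k lower) , <1+⇒≤ (cancel-2k upper)
  where
  cancel-2k : ∀ {i j} → + 2 * (+ k * i) < + 2 * (+ k * j) → i < j
  cancel-2k = *-cancelˡ-<-nonNeg (+ k) ∘ *-cancelˡ-<-nonNeg (+ 2)
  kD<Kd′ : + k * + D < + K * + d
  kD<Kd′ = subst₂ _<_ (pos-* k D) (pos-* K d) (+<+ kD<Kd)
  t+d≤k′ : + t + + d ≤ + k
  t+d≤k′ = subst (_≤ + k) (pos-+ t d) (+≤+ t+d≤k)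
  0<E+2k : +0 < E + + 2 * + k
  0<E+2k = subst (_< E + + 2 * + k) (+-inverseˡ (+ 2 * + k)) (+-monoˡ-< (+ 2 * + k) -2k<E)
  2Kt = + 2 * (+ K * + t)
  2k = + 2 * + k
  open ≤-Reasoning
  lower : + 2 * (+ k * + D) < + 2 * (+ k * (+ 1 + v))
  lower = begin-strict
    + 2 * (+ k * + D)          ≤⟨ *-monoˡ-≤-nonNeg (+ 2) (<⇒≤ kD<Kd′) ⟩
    + 2 * (+ K * + d)          ≤⟨ *-monoˡ-≤-nonNeg (+ 2) (*-monoˡ-≤-nonNeg (+ K) (+≤+ d≤t)) ⟩
    2Kt                        ≡⟨ sym (+-identityʳ 2Kt) ⟩
    2Kt + +0                   <⟨ +-monoʳ-< 2Kt 0<E+2k ⟩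
    2Kt + (E + 2k)             ≡⟨ sym (+-assoc 2Kt E 2k) ⟩
    (2Kt + E) + 2k             ≡⟨ cong (_+ 2k) (sym 2kv≡2Kt+E) ⟩
    + 2 * (+ k * v) + 2k       ≡⟨ distrib (+ k) v ⟩
    + 2 * (+ k * (+ 1 + v))    ∎
    where
    distrib : ∀ k v → + 2 * (k * v) + + 2 * k ≡ + 2 * (k * (+ 1 + v))
    distrib = solve-∀
  upper : + 2 * (+ k * (v + + D)) < + 2 * (+ k * (+ 1 + + K))
  upper = begin-strict
    + 2 * (+ k * (v + + D))                  ≡⟨ distrib (+ k) v (+ D) ⟩
    + 2 * (+ k * v) + + 2 * (+ k * + D)      ≡⟨ cong (_+ + 2 * (+ k * + D)) 2kv≡2Kt+E ⟩
    2Kt + E + + 2 * (+ k * + D)              <⟨ +-monoʳ-< (2Kt + E) (*-monoˡ-<-pos (+ 2) kD<Kd′) ⟩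
    2Kt + E + + 2 * (+ K * + d)              ≤⟨ +-monoˡ-≤ (+ 2 * (+ K * + d)) (+-monoʳ-≤ 2Kt E≤2k) ⟩
    2Kt + 2k + + 2 * (+ K * + d)             ≡⟨ collect (+ k) (+ K) (+ t) (+ d) ⟩
    + 2 * (+ K * (+ t + + d)) + 2k           ≤⟨ +-monoˡ-≤ 2k (*-monoˡ-≤-nonNeg (+ 2) (*-monoˡ-≤-nonNeg (+ K) t+d≤k′)) ⟩
    + 2 * (+ K * + k) + 2k                   ≡⟨ factor (+ k) (+ K) ⟩
    + 2 * (+ k * (+ 1 + + K))                ∎
    where
    distrib : ∀ k v D → + 2 * (k * (v + D)) ≡ + 2 * (k * v) + + 2 * (k * D)
    distrib = solve-∀
    collect : ∀ k K t d → + 2 * (K * t) + + 2 * k + + 2 * (K * d) ≡ + 2 * (K * (t + d)) + + 2 * k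
    collect = solve-∀
    factor : ∀ k K → + 2 * (K * k) + + 2 * k ≡ + 2 * (k * (+ 1 + K))
    factor = solve-∀

difference-bounds : ∀ {m a b} → +0 ≤ a → a < m → +0 ≤ b → b < m → - m < b - a × b - a ≤ m
difference-bounds {m} {a} {b} 0≤a a<m 0≤b b<m = -m<b-a , b-a≤m
  where
  open ≤-Reasoning
  -m<b-a : - m < b - a
  -m<b-a = begin-strict
    - m        <⟨ neg-mono-< a<m ⟩
    - a        ≡⟨ sym (+-identityˡ (- a)) ⟩
    +0 - a     ≤⟨ +-monoˡ-≤ (- a) 0≤b ⟩
    b - a      ∎
  b-a≤m : b - a ≤ m
  b-a≤m = begin
    b - a      ≤⟨ +-monoʳ-≤ b (neg-mono-≤ 0≤a) ⟩
    b - +0     ≡⟨ +-identityʳ b ⟩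
    b          ≤⟨ <⇒≤ b<m ⟩
    m          ∎

complement-bounds : ∀ {m a b} → +0 ≤ a → a < m → +0 ≤ b → b < m → - m < m - (a + b) × m - (a + b) ≤ m
complement-bounds {m} {a} {b} 0≤a a<m 0≤b b<m = -m<m-[a+b] , m-[a+b]≤m
  where
  open ≤-Reasoning
  -m<m-[a+b] : - m < m - (a + b)
  -m<m-[a+b] = begin-strict
    - m              ≡⟨ regroup m ⟩
    m - (m + m)      <⟨ +-monoʳ-< m (neg-mono-< (+-mono-< a<m b<m)) ⟩
    m - (a + b)      ∎
    where
    regroup : ∀ m → - m ≡ m - (m + m)
    regroup = solve-∀
  m-[a+b]≤m : m - (a + b) ≤ m
  m-[a+b]≤m = begin
    m - (a + b)      ≤⟨ +-monoʳ-≤ m (neg-mono-≤ (+-mono-≤ 0≤a 0≤b)) ⟩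
    m - +0           ≡⟨ +-identityʳ m ⟩
    m                ∎

recolour : ∀ (S : SignedGraph) {k K d D} .{{_ : NonZero k}} .{{_ : NonZero K}} (f : Fin k → Fin K) →
           (∀ s i j → d ℕ.≤ ∣ + toℕ i - ⟦ s ⟧ * + toℕ j ∣ k →
                      D ℕ.≤ ∣ + toℕ (f i) - ⟦ s ⟧ * + toℕ (f j) ∣ K) →
           HasKDColoring S k d → HasKDColoring S K D
recolour S f f-far (c , c-ok) = f ∘ c , λ v w e → f-far (σ S v w e) (c v) (c w) (c-ok v w e)

module Rounding (k K : ℕ) .{{_ : NonZero k}} .{{_ : NonZero K}} where

  instance
    2k≢0 : NonZero (2 ℕ.* k)
    2k≢0 = ℕₚ.m*n≢0 2 k

  numerator : ℤ → ℤ
  numerator x = + 2 * x * + K + + k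

  -- ⌊x K / k + 1/2⌋, the nearest integer to x K / k
  round : ℤ → ℤ
  round x = numerator x /ℕ (2 ℕ.* k)

  slack : ℤ → ℕ
  slack x = numerator x %ℕ (2 ℕ.* k)

  slack<2k : ∀ x → + slack x < + 2 * + k
  slack<2k x = subst (+ slack x <_) (pos-* 2 k) (+<+ (n%ℕd<d (numerator x) (2 ℕ.* k)))

  round-spec : ∀ x → + 2 * (+ k * round x) ≡ numerator x - + slack x
  round-spec x = begin
    + 2 * (+ k * round x)                            ≡⟨ *-assoc (+ 2) (+ k) (round x) ⟨
    + 2 * + k * round x                              ≡⟨ cong (_* round x) (pos-* 2 k) ⟨
    + (2 ℕ.* k) * round x                            ≡⟨ regroup (+ (2 ℕ.* k)) (round x) (+ slack x) ⟩
    (+ slack x + round x * + (2 ℕ.* k)) - + slack x  ≡⟨ cong (_- + slack x) (a≡a%ℕn+[a/ℕn]*n (numerator x) (2 ℕ.* k)) ⟨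
    numerator x - + slack x                          ∎
    where
    open ≡-Reasoning
    regroup : ∀ n q r → n * q ≡ (r + q * n) - r
    regroup = solve-∀

  roundingError : Sign → ℤ → ℤ → ℤ
  roundingError plus  x y = + slack y - + slack x
  roundingError minus x y = + 2 * + k - (+ slack x + + slack y)

  roundingError-form : ∀ s x y → + k * (+ 1 - ⟦ s ⟧) - + slack x + ⟦ s ⟧ * + slack y ≡ roundingError s x y
  roundingError-form plus  x y = plus-form (+ k) (+ slack x) (+ slack y)
    where
    plus-form : ∀ k a b → k * (+ 1 - + 1) - a + + 1 * b ≡ b - a
    plus-form = solve-∀
  roundingError-form minus x y = minus-form (+ k) (+ slack x) (+ slack y)
    where
    minus-form : ∀ k a b → k * (+ 1 - - + 1) - a + - + 1 * b ≡ + 2 * k - (a + b)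
    minus-form = solve-∀

  roundingError-bounds : ∀ s x y → - (+ 2 * + k) < roundingError s x y × roundingError s x y ≤ + 2 * + k
  roundingError-bounds plus  x y = difference-bounds (+≤+ z≤n) (slack<2k x) (+≤+ z≤n) (slack<2k y)
  roundingError-bounds minus x y = complement-bounds (+≤+ z≤n) (slack<2k x) (+≤+ z≤n) (slack<2k y)

  round-difference : ∀ s {x y t q} → x - ⟦ s ⟧ * y ≡ + t + q * + k →
    + 2 * (+ k * (round x - ⟦ s ⟧ * round y - q * + K)) ≡ + 2 * (+ K * + t) + roundingError s x y
  round-difference s {x} {y} {t} {q} x-εy≡t+qk = begin
    + 2 * (+ k * (round x - ε * round y - q * + K))
      ≡⟨ expand (+ k) (+ K) ε (round x) (round y) q ⟩
    + 2 * (+ k * round x) - ε * (+ 2 * (+ k * round y)) - + 2 * (+ k * q * + K)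
      ≡⟨ cong₂ (λ a b → a - ε * b - + 2 * (+ k * q * + K)) (round-spec x) (round-spec y) ⟩
    (numerator x - + slack x) - ε * (numerator y - + slack y) - + 2 * (+ k * q * + K)
      ≡⟨ regroup (+ k) (+ K) ε x y (+ slack x) (+ slack y) q ⟩
    + 2 * (+ K * (x - ε * y)) - + 2 * (+ K * (q * + k)) + E
      ≡⟨ cong (λ z → + 2 * (+ K * z) - + 2 * (+ K * (q * + k)) + E) x-εy≡t+qk ⟩
    + 2 * (+ K * (+ t + q * + k)) - + 2 * (+ K * (q * + k)) + E
      ≡⟨ cancel (+ K) (+ t) (q * + k) E ⟩
    + 2 * (+ K * + t) + E
      ≡⟨ cong (λ e → + 2 * (+ K * + t) + e) (roundingError-form s x y) ⟩
    + 2 * (+ K * + t) + roundingError s x y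
      ∎
    where
    open ≡-Reasoning
    ε = ⟦ s ⟧
    E = + k * (+ 1 - ε) - + slack x + ε * + slack y
    expand : ∀ k K ε a b q →
      + 2 * (k * (a - ε * b - q * K)) ≡ + 2 * (k * a) - ε * (+ 2 * (k * b)) - + 2 * (k * q * K)
    expand = solve-∀
    regroup : ∀ k K ε x y a b q →
      (+ 2 * x * K + k - a) - ε * (+ 2 * y * K + k - b) - + 2 * (k * q * K)
        ≡ + 2 * (K * (x - ε * y)) - + 2 * (K * (q * k)) + (k * (+ 1 - ε) - a + ε * b)
    regroup = solve-∀
    cancel : ∀ K t u E → + 2 * (K * (t + u)) - + 2 * (K * u) + E ≡ + 2 * (K * t) + E
    cancel = solve-∀

  round-far : ∀ {d D} → k ℕ.* D ℕ.< K ℕ.* d → ∀ s x y →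
              FarResidue k d (x - ⟦ s ⟧ * y) → FarResidue K D (round x - ⟦ s ⟧ * round y)
  round-far {D = D} kD<Kd s x y (farResidue t q x-εy≡t+qk d≤t t+d≤k) =
    FarResidue-intro q v (shift w (q * + K)) (proj₁ v-bounds) (proj₂ v-bounds)
    where
    w = round x - ⟦ s ⟧ * round y
    v = w - q * + K
    shift : ∀ w u → w ≡ (w - u) + u
    shift = solve-∀
    v-bounds : + D ≤ v × v + + D ≤ + K
    v-bounds = rescale-window kD<Kd d≤t t+d≤k (roundingError-bounds s x y)
                              (round-difference s {q = q} x-εy≡t+qk)

  roundMod : Fin k → Fin K
  roundMod i = fromℕ< (n%ℕd<d (round (+ toℕ i)) K)

  roundMod-far : ∀ {d D} → k ℕ.* D ℕ.< K ℕ.* d → 0 ℕ.< d → 0 ℕ.< D → ∀ s i j →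
                 d ℕ.≤ ∣ + toℕ i - ⟦ s ⟧ * + toℕ j ∣ k →
                 D ℕ.≤ ∣ + toℕ (roundMod i) - ⟦ s ⟧ * + toℕ (roundMod j) ∣ K
  roundMod-far {D = D} kD<Kd 0<d 0<D s i j d≤∣i-εj∣ =
    subst₂ (λ a b → D ℕ.≤ ∣ + a - ⟦ s ⟧ * + b ∣ K) (sym (toℕ-roundMod i)) (sym (toℕ-roundMod j))
      (FarResidue⇒≤∣∣ 0<D (FarResidue-%ℕ ⟦ s ⟧ (round (+ toℕ i)) (round (+ toℕ j))
        (round-far kD<Kd s (+ toℕ i) (+ toℕ j) (≤∣∣⇒FarResidue 0<d d≤∣i-εj∣))))
    where
    toℕ-roundMod : ∀ i → toℕ (roundMod i) ≡ round (+ toℕ i) %ℕ K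
    toℕ-roundMod i = toℕ-fromℕ< (n%ℕd<d (round (+ toℕ i)) K)

theorem12 : (S : SignedGraph) (k d k' d' : ℕ) .{{_ : NonZero k}} .{{_ : NonZero k'}} →
    0 ℕ.< d → 2 ℕ.* d ℕ.≤ k → 0 ℕ.< d' →
    k ℕ.* d' ℕ.< k' ℕ.* d →
    HasKDColoring S k d → HasKDColoring S k' d'
theorem12 S k d k' d' 0<d _ 0<d' kd'<k'd = recolour S roundMod (roundMod-far kd'<k'd 0<d 0<d')
  where open Rounding k k'
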